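{- If $G$ and $H$ are connected graphs with $|G| \ge 2$ and $|H| \ge 2$, then $md(G \circ H) = 1$.
   Context: The lexicographic product $G \circ H$ has vertex set $V(G)\times V(H)$, with $(u,v)$ and $(u',v')$ adjacent if and only if either $uu' \in E(G)$, or $u=u'$ and $vv' \in E(H)$. $|G|$ is the number of vertices. An edge-coloring of a graph $G$ is a map $\Gamma: E(G) \to [k]$ (adjacent edges may receive the same color). An edge-cut is monochromatic if all of its edges have the same color. An edge-coloring of $G$ is a monochromatic disconnection coloring (MD-coloring) if any two distinct vertices $u,v$ of $G$ are separated by a monochromatic edge-cut (equivalently, for some color $i$, $u$ and $v$ lie in different components of the graph obtained by deleting all edges of color $i$). For a connected graph $G$, $md(G)$ is the maximum number of colors in an MD-coloring of $G$. -}

module Defs where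

open import Data.Bool using (Bool; true; false; _∧_; _∨_; T; not)
open import Data.Nat using (ℕ; _≤_)
open import Data.Fin using (Fin)
open import Data.Fin.Properties using () renaming (_≟_ to _≟ᶠ_)
open import Data.Product using (Σ; _×_; _,_; ∃; ∃-syntax)
open import Relation.Nullary using (¬_; Dec; yes; no; does)
open import Relation.Binary.PropositionalEquality using (_≡_; _≢_; refl; sym; trans; cong₂)
open import Data.Empty using (⊥-elim)

record Graph (V : Set) : Set where
  field
    adj     : V → V → Bool
    adj-sym : ∀ u v → adj u v ≡ adj v u
    irrefl  : ∀ u → adj u u ≡ false
open Graph public

data Reach {V : Set} (A : V → V → Set) : V → V → Set where
  here : ∀ {u} → Reach A u u
  step : ∀ {u v w} → A u v → Reach A v w → Reach A u w

Connected : {V : Set} → Graph V → Set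
Connected {V} G = ∀ (u v : V) → Reach (λ x y → T (adj G x y)) u v

lexAdj : ∀ {m n} → Graph (Fin m) → Graph (Fin n) → Fin m × Fin n → Fin m × Fin n → Bool
lexAdj G H (u , v) (u' , v') = adj G u u' ∨ (does (u ≟ᶠ u') ∧ adj H v v')

private
  does-sym : ∀ {m} (u u' : Fin m) → does (u ≟ᶠ u') ≡ does (u' ≟ᶠ u)
  does-sym u u' with u ≟ᶠ u' | u' ≟ᶠ u
  ... | yes _ | yes _ = refl
  ... | no _  | no _  = refl
  ... | yes p | no q  = ⊥-elim (q (sym p))
  ... | no p  | yes q = ⊥-elim (p (sym q))

  does-refl : ∀ {m} (u : Fin m) → does (u ≟ᶠ u) ≡ true
  does-refl u with u ≟ᶠ u
  ... | yes _ = refl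
  ... | no p  = ⊥-elim (p refl)

lexProduct : ∀ {m n} → Graph (Fin m) → Graph (Fin n) → Graph (Fin m × Fin n)
lexProduct G H = record
  { adj     = lexAdj G H
  ; adj-sym = λ { (u , v) (u' , v') →
      cong₂ _∨_ (adj-sym G u u') (cong₂ _∧_ (does-sym u u') (adj-sym H v v')) }
  ; irrefl  = λ { (u , v) →
      trans (cong₂ _∨_ (irrefl G u) (cong₂ _∧_ (does-refl u) (irrefl H v))) refl }
  }

-- An edge-coloring with colors in Fin k: a color for every ordered pair,
-- required to be symmetric on edges (only values on edges matter).
record EdgeColoring {V : Set} (G : Graph V) (k : ℕ) : Set where
  field
    col     : V → V → Fin k
    col-sym : ∀ u v → T (adj G u v) → col u v ≡ col v u
open EdgeColoring public

UsesAllColors : ∀ {V} {G : Graph V} {k} → EdgeColoring G k → Set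
UsesAllColors {V} {G} {k} c = ∀ (i : Fin k) → ∃[ u ] ∃[ v ] (T (adj G u v) × col c u v ≡ i)

AdjMinus : ∀ {V} {G : Graph V} {k} → EdgeColoring G k → Fin k → V → V → Set
AdjMinus {G = G} c i x y = T (adj G x y) × col c x y ≢ i

-- MD-coloring: any two distinct vertices are separated by a monochromatic edge-cut,
-- i.e. for some color i they lie in different components of G minus the color-i edges.
IsMDColoring : ∀ {V} {G : Graph V} {k} → EdgeColoring G k → Set
IsMDColoring {V} c = ∀ (u v : V) → u ≢ v → ∃[ i ] ¬ Reach (AdjMinus c i) u v

IsMD : ∀ {V} → Graph V → ℕ → Set
IsMD G m =
  (Σ (EdgeColoring G m) λ c → IsMDColoring c × UsesAllColors c)
  × (∀ k (c : EdgeColoring G k) → IsMDColoring c → UsesAllColors c → k ≤ m)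

-- The colouring with a single colour is an MD-colouring (deleting its only
-- colour leaves no edges), so md ≥ 1; the content is that no MD-colouring of
-- G ∘ H uses two colours.  The argument has three layers.
--   1. In any graph, an MD-colouring makes every triangle monochromatic: the
--      colour separating the ends of an edge xy must be the colour of xy and
--      must also appear on every path x z y.
--   2. In G ∘ H with G, H free of isolated vertices every edge lies in a
--      triangle with a fixed "reference" fibre edge at its end, so by (1) all
--      edges at a common vertex have one colour (stars are monochromatic).
--   3. In a connected graph a colouring with monochromatic stars is constant,
--      and G ∘ H is connected whenever G is connected without isolated vertices.
-- Hence every MD-colouring of G ∘ H is constant, so it uses at most one colour.
module Submission where

open import Defs
open import Data.Nat using (ℕ; _≤_; zero; suc; z≤n; s≤s)
open import Data.Fin using (Fin; zero; suc; fromℕ<) renaming (_≟_ to _≟ᶠ_)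
open import Data.Bool using (T)
open import Data.Bool.Properties using (T-∨; T-∧)
open import Data.Sum using (_⊎_; inj₁; inj₂)
open import Data.Product using (_×_; _,_; ∃-syntax; proj₁; proj₂)
open import Data.Empty using (⊥-elim)
open import Function.Bundles using (Equivalence)
open import Relation.Nullary using (¬_; yes; no; does)
open import Relation.Nullary.Decidable using (toWitness; fromWitness; isYes≗does)
open import Relation.Binary.PropositionalEquality using (_≡_; _≢_; refl; sym; trans; subst)

Adj : ∀ {V} → Graph V → V → V → Set
Adj G x y = T (adj G x y)

adj-symmetric : ∀ {V} (G : Graph V) {x y} → Adj G x y → Adj G y x
adj-symmetric G {x} {y} = subst T (adj-sym G x y)

adj-distinct : ∀ {V} (G : Graph V) {x y} → Adj G x y → x ≢ y
adj-distinct G {x} xy refl = subst T (irrefl G x) xy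

reach-++ : ∀ {V} {A : V → V → Set} {x y z} → Reach A x y → Reach A y z → Reach A x z
reach-++ here      r′ = r′
reach-++ (step a r) r′ = step a (reach-++ r r′)

reach-map : ∀ {V W} {A : V → V → Set} {B : W → W → Set} (f : V → W) →
  (∀ {x y} → A x y → B (f x) (f y)) → ∀ {x y} → Reach A x y → Reach B (f x) (f y)
reach-map f pres here       = here
reach-map f pres (step a r) = step (pres a) (reach-map f pres r)

NoIsolated : ∀ {V} → Graph V → Set
NoIsolated {V} G = ∀ (u : V) → ∃[ w ] Adj G u w

-- A connected graph on at least two vertices has no isolated vertex: the first
-- step of a walk from u to a different vertex is an edge at u.
connected⇒no-isolated : ∀ {m} (G : Graph (Fin m)) → Connected G → 2 ≤ m → NoIsolated G
connected⇒no-isolated G cG 2≤m u with another 2≤m u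
  where
  another : ∀ {m} → 2 ≤ m → (u : Fin m) → ∃[ v ] u ≢ v
  another (s≤s (s≤s _)) zero    = suc zero , λ ()
  another (s≤s (s≤s _)) (suc _) = zero , λ ()
... | v , u≢v with cG u v
...   | here       = ⊥-elim (u≢v refl)
...   | step uw _  = _ , uw

TriangleRule : ∀ {V} {G : Graph V} {k} → EdgeColoring G k → Set
TriangleRule {V} {G} c =
  ∀ {x y z : V} → Adj G x y → Adj G y z → Adj G x z → col c x y ≡ col c x z

StarsMonochromatic : ∀ {V} {G : Graph V} {k} → EdgeColoring G k → Set
StarsMonochromatic {V} {G} c =
  ∀ {x y z : V} → Adj G x y → Adj G x z → col c x y ≡ col c x z

module _ {V : Set} {G : Graph V} {k : ℕ} (c : EdgeColoring G k) where

  -- Layer 1.  For a triangle, the colour i separating x from y is the colour of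
  -- xy (else xy survives deleting colour i) and is the colour of xz or zy
  -- (else the path x z y survives); so xy shares a colour with xz or zy.
  md-triangle-shares : IsMDColoring c → ∀ {x y z} → Adj G x y → Adj G x z → Adj G z y →
    col c x y ≡ col c x z ⊎ col c x y ≡ col c z y
  md-triangle-shares md {x} {y} {z} xy xz zy with md x y (adj-distinct G xy)
  ... | i , separated with col c x y ≟ᶠ i | col c x z ≟ᶠ i | col c z y ≟ᶠ i
  ...   | no xy≢i | _       | _       = ⊥-elim (separated (step (xy , xy≢i) here))
  ...   | yes xy≡i | yes xz≡i | _      = inj₁ (trans xy≡i (sym xz≡i))
  ...   | yes xy≡i | no _    | yes zy≡i = inj₂ (trans xy≡i (sym zy≡i))
  ...   | yes _   | no xz≢i | no zy≢i =
    ⊥-elim (separated (step (xz , xz≢i) (step (zy , zy≢i) here)))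

  -- Applying the previous lemma at x and at y shows the triangle is monochromatic.
  md-triangle-rule : IsMDColoring c → TriangleRule c
  md-triangle-rule md {x} {y} {z} xy yz xz
    with md-triangle-shares md xy xz (adj-symmetric G yz)
  ... | inj₁ same = same
  ... | inj₂ xy≡zy with md-triangle-shares md xz xy yz
  ...   | inj₁ xz≡xy = sym xz≡xy
  ...   | inj₂ xz≡yz =
    trans xy≡zy (trans (sym (col-sym c y z yz)) (sym xz≡yz))

  -- Layer 3.  With monochromatic stars the colours at the two ends of a walk
  -- agree: consecutive stars share the walk edge.
  stars-agree-along-walk : StarsMonochromatic c → ∀ {p p′ q q′} → Reach (Adj G) p p′ →
    Adj G p q → Adj G p′ q′ → col c p q ≡ col c p′ q′
  stars-agree-along-walk star here pq p′q′ = star pq p′q′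
  stars-agree-along-walk star {p} (step {v = v} pv walk) pq p′q′ =
    trans (star pq pv)
      (trans (col-sym c p v pv) (stars-agree-along-walk star walk (adj-symmetric G pv) p′q′))

  stars-monochromatic⇒constant : StarsMonochromatic c → Connected G →
    ∀ {p q p′ q′} → Adj G p q → Adj G p′ q′ → col c p q ≡ col c p′ q′
  stars-monochromatic⇒constant star cG {p} {p′ = p′} =
    stars-agree-along-walk star (cG p p′)

constant⇒≤1 : ∀ {V} {G : Graph V} {k} (c : EdgeColoring G k) →
  (∀ {p q p′ q′} → Adj G p q → Adj G p′ q′ → col c p q ≡ col c p′ q′) →
  UsesAllColors c → k ≤ 1
constant⇒≤1 {k = zero}        c constant uses = z≤n
constant⇒≤1 {k = suc zero}    c constant uses = s≤s z≤n
constant⇒≤1 {k = suc (suc _)} c constant uses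
  with uses zero | uses (suc zero)
... | _ , _ , e₀ , col≡0 | _ , _ , e₁ , col≡1
  with trans (sym col≡0) (trans (constant e₀ e₁) col≡1)
...   | ()

-- The colouring with a single colour: deleting that colour removes every edge,
-- so distinct vertices are separated, and it uses its colour as soon as G has an edge.
single-colouring : ∀ {V} (G : Graph V) → EdgeColoring G 1
single-colouring G = record { col = λ _ _ → zero ; col-sym = λ _ _ _ → refl }

single-colouring-is-MD : ∀ {V} (G : Graph V) → IsMDColoring (single-colouring G)
single-colouring-is-MD G u v u≢v = zero , no-walk u≢v
  where
  no-walk : ∀ {x y} → x ≢ y → ¬ Reach (AdjMinus (single-colouring G) zero) x y
  no-walk x≢y here               = x≢y refl
  no-walk x≢y (step (_ , ≢0) _) = ≢0 refl

single-colouring-uses-all : ∀ {V} (G : Graph V) {u w : V} → Adj G u w →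
  UsesAllColors (single-colouring G)
single-colouring-uses-all G uw zero = _ , _ , uw , refl

module Lexicographic {m n} (G : Graph (Fin m)) (H : Graph (Fin n)) where

  P : Graph (Fin m × Fin n)
  P = lexProduct G H

  cross-edge : ∀ {u w} x y → Adj G u w → Adj P (u , x) (w , y)
  cross-edge {u} {w} x y uw = Equivalence.from (T-∨ {adj G u w}) (inj₁ uw)

  same-layer-refl : ∀ (u : Fin m) → T (does (u ≟ᶠ u))
  same-layer-refl u = subst T (isYes≗does (u ≟ᶠ u)) (fromWitness refl)

  same-layer-sound : ∀ {u w : Fin m} → T (does (u ≟ᶠ w)) → u ≡ w
  same-layer-sound {u} {w} t = toWitness (subst T (sym (isYes≗does (u ≟ᶠ w))) t)

  fibre-edge : ∀ u {x y} → Adj H x y → Adj P (u , x) (u , y)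
  fibre-edge u xy = Equivalence.from (T-∨ {adj G u u})
    (inj₂ (Equivalence.from (T-∧ {does (u ≟ᶠ u)}) (same-layer-refl u , xy)))

  edge-cases : ∀ {u w x y} → Adj P (u , x) (w , y) → Adj G u w ⊎ (u ≡ w × Adj H x y)
  edge-cases {u} {w} e with Equivalence.to (T-∨ {adj G u w}) e
  ... | inj₁ uw   = inj₁ uw
  ... | inj₂ same with Equivalence.to (T-∧ {does (u ≟ᶠ w)}) same
  ...   | u≡w , xy = inj₂ (same-layer-sound u≡w , xy)

  -- Layer 2.  At (u , x) fix a fibre edge to a reference vertex (u , x′).  A
  -- cross edge forms a triangle with it; a fibre edge forms a triangle with a
  -- cross edge.  Under the triangle rule every edge at (u , x) thus has the
  -- colour of the reference edge.
  lex-stars-monochromatic : NoIsolated G → NoIsolated H → ∀ {k} (c : EdgeColoring P k) →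
    TriangleRule c → StarsMonochromatic c
  lex-stars-monochromatic nG nH c triangle {u , x} e e′ =
    trans (to-reference e) (sym (to-reference e′))
    where
    x′ : Fin n
    x′ = proj₁ (nH x)

    uw₀ : Adj G u (proj₁ (nG u))
    uw₀ = proj₂ (nG u)

    cross-to-reference : ∀ {w y} → Adj G u w → col c (u , x) (w , y) ≡ col c (u , x) (u , x′)
    cross-to-reference {y = y} uw = triangle (cross-edge x y uw)
      (cross-edge y x′ (adj-symmetric G uw)) (fibre-edge u (proj₂ (nH x)))

    to-reference : ∀ {q} → Adj P (u , x) q → col c (u , x) q ≡ col c (u , x) (u , x′)
    to-reference {w , y} e with edge-cases e
    ... | inj₁ uw          = cross-to-reference uw
    ... | inj₂ (refl , _) =
      trans (triangle e (cross-edge y x uw₀) (cross-edge x x uw₀)) (cross-to-reference uw₀)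

  -- G ∘ H is connected: follow a walk of G inside the layer of x, then change
  -- the second coordinate by stepping to a G-neighbour and back.
  lex-connected : Connected G → NoIsolated G → Connected P
  lex-connected cG nG (u , x) (w , y) =
    reach-++ (reach-map (_, x) (cross-edge x x) (cG u w))
      (step (cross-edge x y ww′) (step (cross-edge y y (adj-symmetric G ww′)) here))
    where
    ww′ : Adj G w (proj₁ (nG w))
    ww′ = proj₂ (nG w)

theorem4p6 : ∀ {m n} (G : Graph (Fin m)) (H : Graph (Fin n)) →
    Connected G → Connected H → 2 ≤ m → 2 ≤ n →
    IsMD (lexProduct G H) 1
theorem4p6 G H cG cH 2≤m 2≤n =
  (single-colouring P , single-colouring-is-MD P , single-colouring-uses-all P edge) , at-most-one
  where
  open Lexicographic G H
  nG : NoIsolated G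
  nG = connected⇒no-isolated G cG 2≤m

  nH : NoIsolated H
  nH = connected⇒no-isolated H cH 2≤n

  -- 2 ≤ m is 1 < m, so fromℕ< picks a vertex.
  edge : Adj P (fromℕ< 2≤m , fromℕ< 2≤n) (proj₁ (nG (fromℕ< 2≤m)) , fromℕ< 2≤n)
  edge = cross-edge (fromℕ< 2≤n) (fromℕ< 2≤n) (proj₂ (nG (fromℕ< 2≤m)))

  at-most-one : ∀ k (c : EdgeColoring P k) → IsMDColoring c → UsesAllColors c → k ≤ 1
  at-most-one k c md = constant⇒≤1 c
    (stars-monochromatic⇒constant c
      (lex-stars-monochromatic nG nH c (md-triangle-rule c md)) (lex-connected cG nG))
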